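{- For any vertex $v$ in a DAG $G$, the surrounding price of $v$ equals the persistent price of $v$ minus $1$.
   Context: $\mathrm{pred}(v)$ is the set of immediate predecessors of $v$. A reversible pebbling is a sequence of vertex sets $P_0,\dots,P_\tau$, each obtained from the previous by placing a pebble on some $v\notin P$ with $\mathrm{pred}(v)\subseteq P$, or removing a pebble from some $v\in P$ with $\mathrm{pred}(v)\subseteq P$; its space is $\max_t|P_t|$. The persistent price of $v$ is the minimum space of a reversible pebbling with $P_0=\emptyset$ and $P_\tau=\{v\}$. The surrounding price of $v$ is the minimum space of a reversible pebbling with $P_0=\emptyset$ and $\mathrm{pred}(v)\subseteq P_\tau$. -}

module Defs where

open import Data.Nat using (ℕ; suc; _≤_)
open import Data.Fin using (Fin)
open import Data.Fin.Subset using (Subset; _∈_; _∉_; _⊆_; ∣_∣; ⁅_⁆; inside; outside)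
  renaming (⊥ to ∅)
open import Data.Vec using (_[_]≔_)
open import Data.Product using (Σ; ∃; _×_; _,_)
open import Data.Sum using (_⊎_)
open import Relation.Nullary using (¬_)
open import Relation.Binary.PropositionalEquality using (_≡_)
open import Relation.Binary.Construct.Closure.Transitive using (TransClosure)

-- A finite directed acyclic graph on vertex set Fin n.
-- Edge u v  means there is an edge u → v, i.e. u is an immediate predecessor of v.
record DAG : Set₁ where
  field
    n       : ℕ
    Edge    : Fin n → Fin n → Set
    acyclic : ∀ u → ¬ TransClosure Edge u u
open DAG public

module _ (G : DAG) where

  PredIn : Fin (n G) → Subset (n G) → Set
  PredIn v P = ∀ u → Edge G u v → u ∈ P

  data Move (P : Subset (n G)) : Subset (n G) → Set where
    place  : ∀ v → v ∉ P → PredIn v P → Move P (P [ v ]≔ inside)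
    remove : ∀ v → v ∈ P → PredIn v P → Move P (P [ v ]≔ outside)

  data Pebbling (k : ℕ) : Subset (n G) → Subset (n G) → Set where
    done : ∀ {P} → ∣ P ∣ ≤ k → Pebbling k P P
    step : ∀ {P Q R} → ∣ P ∣ ≤ k → Move P Q → Pebbling k Q R → Pebbling k P R

  PersistentIn : Fin (n G) → ℕ → Set
  PersistentIn v k = Pebbling k ∅ ⁅ v ⁆

  SurroundingIn : Fin (n G) → ℕ → Set
  SurroundingIn v k = Σ (Subset (n G)) λ P → Pebbling k ∅ P × PredIn v P

  IsMin : (ℕ → Set) → ℕ → Set
  IsMin A k = A k × (∀ j → A j → k ≤ j)

  IsPersistentPrice : Fin (n G) → ℕ → Set
  IsPersistentPrice v = IsMin (PersistentIn v)

  IsSurroundingPrice : Fin (n G) → ℕ → Set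
  IsSurroundingPrice v = IsMin (SurroundingIn v)

-- A move on v needs pred(v) pebbled, so a pebbling that eventually moves v passes through a
-- configuration surrounding v just before its first move on v.
-- Persistent price ≤ surrounding price + 1: cut a surrounding pebbling there, so that v is never
-- pebbled; then place v and undo the cut pebbling with v kept on.
-- Surrounding price ≤ persistent price − 1: let N be the set of vertices pebbled before v is
-- first placed in a persistent pebbling; N is closed under predecessors, misses v and contains
-- pred(v). Read the persistent pebbling backwards from {v} until v is first removed: v stays on
-- throughout, so intersecting every configuration with N gives a legal pebbling that saves a
-- pebble and ends surrounding v.
module Submission where

open import Defs
open import Data.Bool using (Bool; _∧_) renaming (_≟_ to _≟ᵇ_)
open import Data.Bool.Properties using (∧-identityʳ; ∧-zeroʳ)
open import Data.Empty using (⊥-elim)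
open import Data.Fin using (Fin; zero; suc; _≟_)
open import Data.Fin.Subset using (Subset; _∈_; _∉_; _⊆_; _∩_; ∣_∣; ⁅_⁆; inside; outside)
  renaming (⊥ to ∅)
open import Data.Fin.Subset.Properties
  using (_∈?_; ∉⊥; ⊥⊆; x∈⁅x⁆; x∈⁅y⁆⇒x≡y; ∣⁅x⁆∣≡1; ∣p∣≤∣x∷p∣; ⊆-antisym; p∩q⊆p; x∈p∩q⁺; x∈p∩q⁻; p⊂q⇒∣p∣<∣q∣)
open import Data.Nat using (ℕ; zero; suc; _≤_; _<_; s≤s)
open import Data.Nat.Properties using (≤-trans; ≤-pred; n≤1+n; m≤n⇒m≤1+n)
open import Data.Product using (∃; _×_; _,_; proj₁; proj₂)
open import Data.Sum using (_⊎_; inj₁; inj₂)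
open import Data.Vec using (Vec; _∷_; lookup; zipWith; _[_]=_; _[_]≔_)
open import Data.Vec.Properties
  using ([]=-injective; []=⇒lookup; lookup⇒[]=; lookup-zipWith; lookup∘update′; []≔-idempotent; []≔-commutes; []≔-updates; []≔-minimal; []≔-lookup)
open import Function using (_∘_)
open import Relation.Nullary using (¬_; yes; no)
open import Relation.Binary.PropositionalEquality using (_≡_; _≢_; refl; sym; trans; cong; subst; module ≡-Reasoning)
open import Relation.Binary.Construct.Closure.Transitive using ([_])

private variable
  m : ℕ
  A B C : Set
  x y : Fin m
  b : Bool
  p q : Subset m

zipWith-[]≔ˡ : ∀ (f : A → B → C) (xs : Vec A m) ys i z →
               zipWith f (xs [ i ]≔ z) ys ≡ zipWith f xs ys [ i ]≔ f z (lookup ys i)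
zipWith-[]≔ˡ f (x ∷ xs) (y ∷ ys) zero    z = refl
zipWith-[]≔ˡ f (x ∷ xs) (y ∷ ys) (suc i) z = cong (f x y ∷_) (zipWith-[]≔ˡ f xs ys i z)

[]≔-undo : ∀ (xs : Vec A m) i {z w} → lookup xs i ≡ w → (xs [ i ]≔ z) [ i ]≔ w ≡ xs
[]≔-undo xs i {z} {w} xsᵢ≡w = begin
  (xs [ i ]≔ z) [ i ]≔ w     ≡⟨ []≔-idempotent xs i ⟩
  xs [ i ]≔ w                ≡⟨ cong (xs [ i ]≔_) (sym xsᵢ≡w) ⟩
  xs [ i ]≔ lookup xs i      ≡⟨ []≔-lookup xs i ⟩
  xs                         ∎
  where open ≡-Reasoning

∉⇒lookup≡outside : x ∉ p → lookup p x ≡ outside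
∉⇒lookup≡outside {x = x} {p = p} x∉p with lookup p x in eq
... | inside  = ⊥-elim (x∉p (lookup⇒[]= x p eq))
... | outside = refl

∉⇒[]=outside : x ∉ p → p [ x ]= outside
∉⇒[]=outside = lookup⇒[]= _ _ ∘ ∉⇒lookup≡outside

[]=outside⇒∉ : p [ x ]= outside → x ∉ p
[]=outside⇒∉ p[x]=outside x∈p with []=-injective x∈p p[x]=outside
... | ()

x∈p[x]≔inside : x ∈ p [ x ]≔ inside
x∈p[x]≔inside {x = x} {p = p} = []≔-updates p x

x∉p[x]≔outside : x ∉ p [ x ]≔ outside
x∉p[x]≔outside {x = x} {p = p} = []=outside⇒∉ ([]≔-updates p x)

∈-[]≔⁺ : x ≢ y → x ∈ p → x ∈ p [ y ]≔ b
∈-[]≔⁺ {x = x} {y = y} {p = p} x≢y = []≔-minimal p x y x≢y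

∈-[]≔⁻ : x ∈ p [ y ]≔ b → x ≡ y ⊎ x ∈ p
∈-[]≔⁻ {x = x} {p = p} {y = y} {b = b} x∈p′ with x ≟ y
... | yes x≡y = inj₁ x≡y
... | no  x≢y = inj₂ (lookup⇒[]= x p (trans (sym (lookup∘update′ x≢y p b)) ([]=⇒lookup x∈p′)))

p⊆p[x]≔inside : p ⊆ p [ x ]≔ inside
p⊆p[x]≔inside {x = x} {y} y∈p with y ≟ x
... | yes refl = x∈p[x]≔inside
... | no  y≢x  = ∈-[]≔⁺ y≢x y∈p

p[x]≔outside⊆p : p [ x ]≔ outside ⊆ p
p[x]≔outside⊆p y∈p′ with ∈-[]≔⁻ y∈p′
... | inj₁ refl = ⊥-elim (x∉p[x]≔outside y∈p′)
... | inj₂ y∈p  = y∈p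

[]≔inside-mono : p ⊆ q → p [ x ]≔ inside ⊆ q [ x ]≔ inside
[]≔inside-mono p⊆q y∈p′ with ∈-[]≔⁻ y∈p′
... | inj₁ refl = x∈p[x]≔inside
... | inj₂ y∈p  = p⊆p[x]≔inside (p⊆q y∈p)

∣p[x]≔inside∣≤1+∣p∣ : ∀ (p : Subset m) x → ∣ p [ x ]≔ inside ∣ ≤ suc ∣ p ∣
∣p[x]≔inside∣≤1+∣p∣ (s ∷ p)       zero    = s≤s (∣p∣≤∣x∷p∣ s p)
∣p[x]≔inside∣≤1+∣p∣ (inside ∷ p)  (suc x) = s≤s (∣p[x]≔inside∣≤1+∣p∣ p x)
∣p[x]≔inside∣≤1+∣p∣ (outside ∷ p) (suc x) = ∣p[x]≔inside∣≤1+∣p∣ p x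

⁅x⁆≡∅[x]≔inside : ∀ (x : Fin m) → ⁅ x ⁆ ≡ ∅ [ x ]≔ inside
⁅x⁆≡∅[x]≔inside zero    = refl
⁅x⁆≡∅[x]≔inside (suc x) = cong (outside ∷_) (⁅x⁆≡∅[x]≔inside x)

⁅x⁆∩p≡∅ : x ∉ p → ⁅ x ⁆ ∩ p ≡ ∅
⁅x⁆∩p≡∅ {x = x} {p = p} x∉p = ⊆-antisym ⁅x⁆∩p⊆∅ ⊥⊆
  where
  ⁅x⁆∩p⊆∅ : ⁅ x ⁆ ∩ p ⊆ ∅
  ⁅x⁆∩p⊆∅ y∈⁅x⁆∩p with x∈p∩q⁻ ⁅ x ⁆ p y∈⁅x⁆∩p
  ... | y∈⁅x⁆ , y∈p = ⊥-elim (x∉p (subst (_∈ p) (x∈⁅y⁆⇒x≡y x y∈⁅x⁆) y∈p))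

∣p∩q∣<∣p∣ : x ∈ p → x ∉ q → ∣ p ∩ q ∣ < ∣ p ∣
∣p∩q∣<∣p∣ {x = x} {p = p} {q = q} x∈p x∉q =
  p⊂q⇒∣p∣<∣q∣ (p∩q⊆p p q , x , x∈p , x∉q ∘ proj₂ ∘ x∈p∩q⁻ p q)

[]≔-∩ : ∀ (p : Subset m) → x ∈ q → (p [ x ]≔ b) ∩ q ≡ (p ∩ q) [ x ]≔ b
[]≔-∩ {x = x} {q = q} {b = b} p x∈q = begin
  (p [ x ]≔ b) ∩ q                    ≡⟨ zipWith-[]≔ˡ _∧_ p q x b ⟩
  (p ∩ q) [ x ]≔ (b ∧ lookup q x)     ≡⟨ cong (λ c → (p ∩ q) [ x ]≔ (b ∧ c)) ([]=⇒lookup x∈q) ⟩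
  (p ∩ q) [ x ]≔ (b ∧ inside)         ≡⟨ cong ((p ∩ q) [ x ]≔_) (∧-identityʳ b) ⟩
  (p ∩ q) [ x ]≔ b                    ∎
  where open ≡-Reasoning

[]≔-∩-∉ : ∀ (p : Subset m) → x ∉ q → (p [ x ]≔ b) ∩ q ≡ p ∩ q
[]≔-∩-∉ {x = x} {q = q} {b = b} p x∉q = begin
  (p [ x ]≔ b) ∩ q                          ≡⟨ zipWith-[]≔ˡ _∧_ p q x b ⟩
  (p ∩ q) [ x ]≔ (b ∧ lookup q x)           ≡⟨ cong ((p ∩ q) [ x ]≔_) (trans (∧-q[x] b) (sym (∧-q[x] (lookup p x)))) ⟩
  (p ∩ q) [ x ]≔ (lookup p x ∧ lookup q x)  ≡⟨ cong ((p ∩ q) [ x ]≔_) (sym (lookup-zipWith _∧_ x p q)) ⟩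
  (p ∩ q) [ x ]≔ lookup (p ∩ q) x           ≡⟨ []≔-lookup (p ∩ q) x ⟩
  p ∩ q                                     ∎
  where
  open ≡-Reasoning
  ∧-q[x] : ∀ c → c ∧ lookup q x ≡ outside
  ∧-q[x] c = trans (cong (c ∧_) (∉⇒lookup≡outside x∉q)) (∧-zeroʳ c)

module _ (G : DAG) where

  private variable
    j k : ℕ
    u v : Fin (n G)
    P Q R N : Subset (n G)

  Edge⇒≢ : Edge G u v → u ≢ v
  Edge⇒≢ e refl = acyclic G _ [ e ]

  PredIn-mono : P ⊆ Q → PredIn G v P → PredIn G v Q
  PredIn-mono P⊆Q pred u e = P⊆Q (pred u e)

  PredIn-∩ : PredIn G v P → PredIn G v Q → PredIn G v (P ∩ Q)
  PredIn-∩ predP predQ u e = x∈p∩q⁺ (predP u e , predQ u e)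

  Move-sym : Move G P Q → Move G Q P
  Move-sym {P} (place u u∉P pred) =
    subst (Move G _) ([]≔-undo P u (∉⇒lookup≡outside u∉P))
      (remove u x∈p[x]≔inside (PredIn-mono p⊆p[x]≔inside pred))
  Move-sym {P} (remove u u∈P pred) =
    subst (Move G _) ([]≔-undo P u ([]=⇒lookup u∈P))
      (place u x∉p[x]≔outside (λ w e → ∈-[]≔⁺ (Edge⇒≢ e) (pred w e)))

  Pebbling-head : Pebbling G k P Q → ∣ P ∣ ≤ k
  Pebbling-head (done ∣P∣≤k)     = ∣P∣≤k
  Pebbling-head (step ∣P∣≤k _ _) = ∣P∣≤k

  _++_ : Pebbling G k P Q → Pebbling G k Q R → Pebbling G k P R
  done _         ++ s = s
  step ∣P∣≤k m r ++ s = step ∣P∣≤k m (r ++ s)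

  reverse : Pebbling G k P Q → Pebbling G k Q P
  reverse (done ∣P∣≤k)     = done ∣P∣≤k
  reverse (step ∣P∣≤k m r) = reverse r ++ step (Pebbling-head r) (Move-sym m) (done ∣P∣≤k)

  Pebbling-mono : j ≤ k → Pebbling G j P Q → Pebbling G k P Q
  Pebbling-mono j≤k (done ∣P∣≤j)     = done (≤-trans ∣P∣≤j j≤k)
  Pebbling-mono j≤k (step ∣P∣≤j m r) = step (≤-trans ∣P∣≤j j≤k) m (Pebbling-mono j≤k r)

  ¬PersistentIn-0 : ¬ PersistentIn G v 0
  ¬PersistentIn-0 {v} p with subst (_≤ 0) (∣⁅x⁆∣≡1 v) (Pebbling-head (reverse p))
  ... | ()

  data Pebbling⟨_⟩ (I : Subset (n G) → Set) (k : ℕ) : Subset (n G) → Subset (n G) → Set where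
    done : I P → ∣ P ∣ ≤ k → Pebbling⟨ I ⟩ k P P
    step : I P → ∣ P ∣ ≤ k → Move G P Q → Pebbling⟨ I ⟩ k Q R → Pebbling⟨ I ⟩ k P R

  module _ {I : Subset (n G) → Set} where

    forget : Pebbling⟨ I ⟩ k P Q → Pebbling G k P Q
    forget (done _ ∣P∣≤k)     = done ∣P∣≤k
    forget (step _ ∣P∣≤k m r) = step ∣P∣≤k m (forget r)

    Pebbling⟨⟩-head : Pebbling⟨ I ⟩ k P Q → I P
    Pebbling⟨⟩-head (done IP _)     = IP
    Pebbling⟨⟩-head (step IP _ _ _) = IP

    Pebbling⟨⟩-last : Pebbling⟨ I ⟩ k P Q → I Q × ∣ Q ∣ ≤ k
    Pebbling⟨⟩-last (done IP ∣P∣≤k) = IP , ∣P∣≤k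
    Pebbling⟨⟩-last (step _ _ _ r)  = Pebbling⟨⟩-last r

    Pebbling⟨⟩-map : ∀ {J} → (∀ {X} → I X → J X) → Pebbling⟨ I ⟩ k P Q → Pebbling⟨ J ⟩ k P Q
    Pebbling⟨⟩-map f (done IP ∣P∣≤k)     = done (f IP) ∣P∣≤k
    Pebbling⟨⟩-map f (step IP ∣P∣≤k m r) = step (f IP) ∣P∣≤k m (Pebbling⟨⟩-map f r)

  Move-changing⇒PredIn : Move G P Q → P [ v ]= b → ¬ Q [ v ]= b → PredIn G v P
  Move-changing⇒PredIn {P} {v = v} (place u _ pred) vP ¬vQ with u ≟ v
  ... | yes refl = pred
  ... | no  u≢v  = ⊥-elim (¬vQ ([]≔-minimal P v u (u≢v ∘ sym) vP))
  Move-changing⇒PredIn {P} {v = v} (remove u _ pred) vP ¬vQ with u ≟ v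
  ... | yes refl = pred
  ... | no  u≢v  = ⊥-elim (¬vQ ([]≔-minimal P v u (u≢v ∘ sym) vP))

  -- The prefix before the first move on v; that move needs pred(v) pebbled.
  surrounding-prefix : Pebbling G k P R → P [ v ]= b → (¬ R [ v ]= b) ⊎ PredIn G v R →
                       ∃ λ Q → Pebbling⟨ _[ v ]= b ⟩ k P Q × PredIn G v Q
  surrounding-prefix (done _) vP (inj₁ ¬vR)    = ⊥-elim (¬vR vP)
  surrounding-prefix (done ∣P∣≤k) vP (inj₂ pred) = _ , done vP ∣P∣≤k , pred
  surrounding-prefix {v = v} {b} (step {Q = Q} ∣P∣≤k m r) vP end with lookup Q v ≟ᵇ b
  ... | no ¬vQ = _ , done vP ∣P∣≤k , Move-changing⇒PredIn m vP (¬vQ ∘ []=⇒lookup)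
  ... | yes vQ with surrounding-prefix r (lookup⇒[]= v Q vQ) end
  ...   | R′ , r′ , pred = R′ , step vP ∣P∣≤k m r′ , pred

  Move-insert : v ∉ P → v ∉ Q → Move G P Q → Move G (P [ v ]≔ inside) (Q [ v ]≔ inside)
  Move-insert {v} {P} v∉P v∉Q (place u u∉P pred) =
    subst (Move G _) ([]≔-commutes P v u v≢u)
      (place u (λ u∈P′ → u∉P (u∈P[v]≔inside⇒u∈P u∈P′)) (PredIn-mono p⊆p[x]≔inside pred))
    where
    v≢u : v ≢ u
    v≢u refl = v∉Q x∈p[x]≔inside
    u∈P[v]≔inside⇒u∈P : u ∈ P [ v ]≔ inside → u ∈ P
    u∈P[v]≔inside⇒u∈P u∈P′ with ∈-[]≔⁻ u∈P′
    ... | inj₁ u≡v = ⊥-elim (v≢u (sym u≡v))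
    ... | inj₂ u∈P = u∈P
  Move-insert {v} {P} v∉P v∉Q (remove u u∈P pred) =
    subst (Move G _) ([]≔-commutes P v u v≢u)
      (remove u (p⊆p[x]≔inside u∈P) (PredIn-mono p⊆p[x]≔inside pred))
    where
    v≢u : v ≢ u
    v≢u refl = v∉P u∈P

  Pebbling-insert : Pebbling⟨ v ∉_ ⟩ k P Q →
                    Pebbling G (suc k) (P [ v ]≔ inside) (Q [ v ]≔ inside)
  Pebbling-insert {v} {P = P} (done _ ∣P∣≤k) =
    done (≤-trans (∣p[x]≔inside∣≤1+∣p∣ P v) (s≤s ∣P∣≤k))
  Pebbling-insert {v} {P = P} (step v∉P ∣P∣≤k m r) =
    step (≤-trans (∣p[x]≔inside∣≤1+∣p∣ P v) (s≤s ∣P∣≤k))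
         (Move-insert v∉P (Pebbling⟨⟩-head r) m) (Pebbling-insert r)

  PredClosed : Subset (n G) → Set
  PredClosed N = ∀ {u} → u ∈ N → PredIn G u N

  -- Each placed vertex is added to the cover; its predecessors are pebbled, so closure is kept.
  Move-closed-cover : PredClosed N → v ∉ N → P ⊆ N → v ∉ Q → Move G P Q →
                      ∃ λ N′ → PredClosed N′ × v ∉ N′ × Q ⊆ N′
  Move-closed-cover {N} closed v∉N P⊆N v∉Q (place u _ pred) =
    N [ u ]≔ inside , closed′ , v∉N′ , []≔inside-mono P⊆N
    where
    closed′ : PredClosed (N [ u ]≔ inside)
    closed′ x∈N′ w e with ∈-[]≔⁻ x∈N′
    ... | inj₁ refl = p⊆p[x]≔inside (P⊆N (pred w e))
    ... | inj₂ x∈N  = p⊆p[x]≔inside (closed x∈N w e)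
    v∉N′ : _ ∉ N [ u ]≔ inside
    v∉N′ v∈N′ with ∈-[]≔⁻ v∈N′
    ... | inj₁ refl = v∉Q x∈p[x]≔inside
    ... | inj₂ v∈N  = v∉N v∈N
  Move-closed-cover {N} closed v∉N P⊆N v∉Q (remove u _ _) =
    N , closed , v∉N , P⊆N ∘ p[x]≔outside⊆p

  Pebbling-closed-cover : PredClosed N → v ∉ N → P ⊆ N → Pebbling⟨ v ∉_ ⟩ k P Q →
                          ∃ λ N′ → PredClosed N′ × v ∉ N′ × Q ⊆ N′
  Pebbling-closed-cover {N} closed v∉N P⊆N (done _ _) = N , closed , v∉N , P⊆N
  Pebbling-closed-cover closed v∉N P⊆N (step _ _ m r)
    with Move-closed-cover closed v∉N P⊆N (Pebbling⟨⟩-head r) m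
  ... | N′ , closed′ , v∉N′ , Q⊆N′ = Pebbling-closed-cover closed′ v∉N′ Q⊆N′ r

  Move-restrict : PredClosed N → Move G P Q → Move G (P ∩ N) (Q ∩ N) ⊎ P ∩ N ≡ Q ∩ N
  Move-restrict {N} {P} closed (place u u∉P pred) with u ∈? N
  ... | yes u∈N = inj₁ (subst (Move G _) (sym ([]≔-∩ P u∈N))
                    (place u (u∉P ∘ p∩q⊆p P N) (PredIn-∩ pred (closed u∈N))))
  ... | no  u∉N = inj₂ (sym ([]≔-∩-∉ P u∉N))
  Move-restrict {N} {P} closed (remove u u∈P pred) with u ∈? N
  ... | yes u∈N = inj₁ (subst (Move G _) (sym ([]≔-∩ P u∈N))
                    (remove u (x∈p∩q⁺ (u∈P , u∈N)) (PredIn-∩ pred (closed u∈N))))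
  ... | no  u∉N = inj₂ (sym ([]≔-∩-∉ P u∉N))

  Pebbling-restrict : PredClosed N → v ∉ N → Pebbling⟨ v ∈_ ⟩ (suc k) P Q →
                      Pebbling G k (P ∩ N) (Q ∩ N)
  Pebbling-restrict closed v∉N (done v∈P ∣P∣≤1+k) =
    done (≤-pred (≤-trans (∣p∩q∣<∣p∣ v∈P v∉N) ∣P∣≤1+k))
  Pebbling-restrict closed v∉N (step v∈P ∣P∣≤1+k m r) with Move-restrict closed m
  ... | inj₁ m′ =
    step (≤-pred (≤-trans (∣p∩q∣<∣p∣ v∈P v∉N) ∣P∣≤1+k)) m′ (Pebbling-restrict closed v∉N r)
  ... | inj₂ eq = subst (λ X → Pebbling G _ X _) (sym eq) (Pebbling-restrict closed v∉N r)

  surrounding⇒persistent : SurroundingIn G v k → PersistentIn G v (suc k)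
  surrounding⇒persistent {v} {k} (_ , p , pred) with surrounding-prefix p (∉⇒[]=outside ∉⊥) (inj₂ pred)
  ... | Q , prefix , pred-Q =
    Pebbling-mono (n≤1+n k) (forget avoiding)
      ++ step (m≤n⇒m≤1+n ∣Q∣≤k) (place v v∉Q pred-Q) undo-with-v
    where
    avoiding : Pebbling⟨ v ∉_ ⟩ k ∅ Q
    avoiding = Pebbling⟨⟩-map []=outside⇒∉ prefix
    v∉Q : v ∉ Q
    v∉Q = proj₁ (Pebbling⟨⟩-last avoiding)
    ∣Q∣≤k : ∣ Q ∣ ≤ k
    ∣Q∣≤k = proj₂ (Pebbling⟨⟩-last avoiding)
    undo-with-v : Pebbling G (suc k) (Q [ v ]≔ inside) ⁅ v ⁆
    undo-with-v = subst (Pebbling G (suc k) _) (sym (⁅x⁆≡∅[x]≔inside v)) (reverse (Pebbling-insert avoiding))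

  persistent⇒surrounding : PersistentIn G v (suc k) → SurroundingIn G v k
  persistent⇒surrounding {v} p
    with surrounding-prefix p (∉⇒[]=outside ∉⊥) (inj₁ (λ ⁅v⁆[v]=outside → []=outside⇒∉ ⁅v⁆[v]=outside (x∈⁅x⁆ v)))
  ... | P , before-v , pred-P
    with Pebbling-closed-cover (⊥-elim ∘ ∉⊥) ∉⊥ ⊥⊆ (Pebbling⟨⟩-map []=outside⇒∉ before-v)
       | surrounding-prefix (reverse p) (x∈⁅x⁆ v) (inj₁ ∉⊥)
  ... | N , N-closed , v∉N , P⊆N | Q , holding-v , pred-Q =
    Q ∩ N ,
    subst (λ X → Pebbling G _ X (Q ∩ N)) (⁅x⁆∩p≡∅ v∉N) (Pebbling-restrict N-closed v∉N holding-v) ,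
    PredIn-∩ pred-Q (PredIn-mono P⊆N pred-P)

proposition2p1 : (G : DAG) (v : Fin (n G)) (k : ℕ) → (IsSurroundingPrice G v k → IsPersistentPrice G v (suc k)) × (IsPersistentPrice G v (suc k) → IsSurroundingPrice G v k)
proposition2p1 G v k = surrounding⇒persistent-price , persistent⇒surrounding-price
  where
  surrounding⇒persistent-price : IsSurroundingPrice G v k → IsPersistentPrice G v (suc k)
  surrounding⇒persistent-price (s , minimal) =
    surrounding⇒persistent G s ,
    λ { zero    p → ⊥-elim (¬PersistentIn-0 G p)
      ; (suc j) p → s≤s (minimal j (persistent⇒surrounding G p)) }

  persistent⇒surrounding-price : IsPersistentPrice G v (suc k) → IsSurroundingPrice G v k
  persistent⇒surrounding-price (p , minimal) =
    persistent⇒surrounding G p , λ j s → ≤-pred (minimal (suc j) (surrounding⇒persistent G s))
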